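{- Let $n=2^s$ and $q=2^r$ with $s,r$ positive integers. For $\beta\in\mathbb{F}_q$ let $$\delta(n-1,q;\beta)=|\{(\alpha_1,\dots,\alpha_{n-1})\in(\mathbb{F}_q^*)^{n-1}:\alpha_1+\cdots+\alpha_{n-1}+\alpha_1^{ -1}\cdots\alpha_{n-1}^{ -1}=\beta\}|.$$ Then $\delta(n-1,q;0)=q^{ -1}\{(q-1)^{n-1}+1\}$, and for $\beta\in\mathbb{F}_q^*$, $$\delta(n-1,q;\beta)=K_{n-2}(\lambda;\beta^{ -1})+q^{ -1}\{(q-1)^{n-1}+1\}.$$
   Context: $tr(x)=x+x^2+\cdots+x^{2^{r-1}}$ is the absolute trace $\mathbb{F}_q\to\mathbb{F}_2$ and $\lambda(x)=(-1)^{tr(x)}$. For $m\ge1$ and $a\in\mathbb{F}_q^*$, $K_m(\lambda;a)=\sum_{\alpha_1,\dots,\alpha_m\in\mathbb{F}_q^*}\lambda(\alpha_1+\cdots+\alpha_m+a\alpha_1^{ -1}\cdots\alpha_m^{ -1})$, with the convention $K_0(\lambda;a)=\lambda(a)$. -}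

module Defs where

open import Data.Nat using (ℕ; zero; suc)
open import Data.Integer as ℤ using (ℤ; +_; -[1+_])
open import Data.List using (List; []; _∷_; map; filter; length; cartesianProductWith)
import Data.List as L
open import Data.List.Membership.Propositional using (_∈_)
open import Data.List.Relation.Unary.Unique.Propositional using (Unique)
open import Data.Vec using (Vec; []; _∷_; foldr)
open import Relation.Binary.PropositionalEquality using (_≡_)
open import Relation.Binary.Definitions using (DecidableEquality)
open import Relation.Nullary using (¬_; does; yes; no; ¬?)
open import Algebra.Structures using (IsCommutativeRing)
open import Data.Bool using (if_then_else_)

-- A finite field with exactly 2^r elements (i.e. F_q, q = 2^r), with
-- propositional equality, decidable equality, an explicit enumeration,
-- and the field inverse as a total function (the value at 0 is irrelevant).
record FiniteField (q : ℕ) : Set₁ where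
  field
    F        : Set
    _+_ _*_  : F → F → F
    -_       : F → F
    0# 1#    : F
    isCommutativeRing : IsCommutativeRing _≡_ _+_ _*_ -_ 0# 1#
    0≢1      : ¬ (0# ≡ 1#)
    inv      : F → F
    inv-r    : ∀ x → ¬ (x ≡ 0#) → x * inv x ≡ 1#
    _≟_      : DecidableEquality F
    elems    : List F
    complete : ∀ x → x ∈ elems
    unique   : Unique elems
    card     : length elems ≡ q

module _ {q : ℕ} (K : FiniteField q) where
  open FiniteField K

  units : List F
  units = filter (λ x → ¬? (x ≟ 0#)) elems

  tuples : (m : ℕ) → List (Vec F m)
  tuples zero = [] ∷ []
  tuples (suc m) = cartesianProductWith _∷_ units (tuples m)

  vsum : ∀ {m} → Vec F m → F
  vsum = foldr _ _+_ 0#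

  vprod : ∀ {m} → Vec F m → F
  vprod = foldr _ _*_ 1#

  sqIter : ℕ → F → F
  sqIter zero x = x
  sqIter (suc i) x = sqIter i (x * x)

  -- absolute trace tr(x) = x + x^2 + ... + x^(2^(r-1))
  tr : ℕ → F → F
  tr zero x = 0#
  tr (suc i) x = tr i x + sqIter i x

  λχ : ℕ → F → ℤ
  λχ r x = if does (tr r x ≟ 0#) then + 1 else -[1+ 0 ]

  Kloost : ℕ → ℕ → F → ℤ
  Kloost r zero a = λχ r a
  Kloost r (suc m) a =
    L.foldr ℤ._+_ (+ 0) (map (λ v → λχ r (vsum v + (a * inv (vprod v)))) (tuples (suc m)))

  δ : (m : ℕ) → F → ℕ
  δ m β = length (filter (λ v → (vsum v + inv (vprod v)) ≟ β) (tuples m))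

-- Let m = n - 1, q = 2^r and b = β^n. Orthogonality of the additive character λ turns
-- q δ(m, q; β) into ∑_{x ∈ F_q} λ(xβ) ∑_α λ(x(α₁ + ⋯ + α_m + (α₁⋯α_m)⁻¹)). The term x = 0 gives
-- (q - 1)^m. For x ≠ 0 the substitution α ↦ xα, together with m + 1 = n, turns the inner sum
-- into K_m(λ; x^n); since x ↦ x^n is an automorphism of F_q fixing λ, what remains is
-- ∑_{a ≠ 0} λ(ab) K_m(λ; a). Completing this sum by the term a = 0 costs ∑_α λ(α₁ + ⋯ + α_m)
-- = (-1)^m = -1, and summing over a first leaves q ∑_α λ(α₁ + ⋯ + α_m) [b α₁⋯α_m = 1]. This is 0
-- for β = 0; otherwise solving for α₁ gives q K_{m-1}(λ; b⁻¹) = q K_{m-1}(λ; β⁻¹).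
-- The facts about F_q that are used (characteristic 2 and x^q = x, both from Fermat's little
-- theorem, and an element of trace 1, from the root bound for the trace polynomial of degree
-- 2^(r-1) < q) are derived from the field axioms alone.

{-# OPTIONS --safe #-}
module Submission where

open import Defs
open import Algebra.Bundles using (CommutativeMonoid; CommutativeRing)
open import Algebra.Core using (Op₂)
open import Algebra.Structures using (IsCommutativeMonoid)
open import Data.Bool using (if_then_else_)
open import Data.Empty using (⊥-elim)
open import Data.Integer as ℤ using (ℤ; +_; -_; _+_; _*_; -1ℤ)
import Data.Integer.Properties as ℤ
open import Data.Integer.Tactic.RingSolver using (solve-∀)
open import Data.List as List using (List; []; _∷_; _++_; map; filter; length; cartesianProductWith)
open import Data.List.Membership.Propositional using (_∈_)
open import Data.List.Membership.Propositional.Properties using (∈-filter⁺; ∈-filter⁻; ∈-map⁺; ∈-map⁻)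
open import Data.List.Properties using (filter-accept; filter-reject; filter-all)
open import Data.List.Relation.Unary.All as All using (All; []; _∷_)
open import Data.List.Relation.Unary.All.Properties using (¬All⇒Any¬)
open import Data.List.Relation.Unary.Any using (here; there; satisfied)
open import Data.List.Relation.Unary.Unique.Propositional using (Unique)
open import Data.List.Relation.Unary.AllPairs using ([]; _∷_)
import Data.List.Relation.Unary.Unique.Propositional.Properties as Unique
import Data.Nat
open import Data.Nat as ℕ using (ℕ; zero; suc; _≤_; _^_; _∸_; z≤n; s≤s)
import Data.Nat.Properties as ℕ
open import Data.Product using (_×_; _,_; proj₁; proj₂; Σ-syntax)
open import Data.Sum using (_⊎_; inj₁; inj₂)
open import Data.Vec as Vec using (Vec; []; _∷_)
open import Data.Vec.Relation.Unary.All as AllV using ([]; _∷_)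
open import Function using (_∘_; id)
open import Level using (0ℓ)
open import Relation.Binary.Definitions using (DecidableEquality)
open import Relation.Binary.PropositionalEquality
  using (_≡_; _≢_; refl; sym; trans; cong; cong₂; subst; module ≡-Reasoning)
open import Relation.Nullary using (¬_; Dec; yes; no; does; ¬?)
open import Relation.Unary using (Pred)

module ListSum {A : Set} {_∙_ : Op₂ A} {ε : A} (isCommutativeMonoid : IsCommutativeMonoid _≡_ _∙_ ε) where
  private
    commutativeMonoid : CommutativeMonoid _ _
    commutativeMonoid = record { isCommutativeMonoid = isCommutativeMonoid }
  open CommutativeMonoid commutativeMonoid using (assoc; identityˡ; identityʳ; commutativeSemigroup)
  open import Algebra.Properties.CommutativeSemigroup commutativeSemigroup using (interchange; x∙yz≈y∙xz)

  ∑ : {B : Set} → List B → (B → A) → A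
  ∑ xs f = List.foldr _∙_ ε (map f xs)

  infix 5 ∑
  syntax ∑ xs (λ x → e) = ∑[ x ← xs ] e

  private variable B C D : Set

  ∑-cong : (xs : List B) {f g : B → A} → (∀ {x} → x ∈ xs → f x ≡ g x) → ∑ xs f ≡ ∑ xs g
  ∑-cong []       f≗g = refl
  ∑-cong (x ∷ xs) f≗g = cong₂ _∙_ (f≗g (here refl)) (∑-cong xs (f≗g ∘ there))

  ∑-++ : (xs ys : List B) (f : B → A) → ∑ (xs ++ ys) f ≡ ∑ xs f ∙ ∑ ys f
  ∑-++ []       ys f = sym (identityˡ _)
  ∑-++ (x ∷ xs) ys f = trans (cong (f x ∙_) (∑-++ xs ys f)) (sym (assoc _ _ _))

  ∑-map : (g : C → B) (xs : List C) (f : B → A) → ∑ (map g xs) f ≡ ∑ xs (f ∘ g)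
  ∑-map g []       f = refl
  ∑-map g (x ∷ xs) f = cong (f (g x) ∙_) (∑-map g xs f)

  ∑-ε : (xs : List B) → ∑[ _ ← xs ] ε ≡ ε
  ∑-ε []       = refl
  ∑-ε (x ∷ xs) = trans (identityˡ _) (∑-ε xs)

  ∑-∙ : (xs : List B) (f g : B → A) → ∑[ x ← xs ] (f x ∙ g x) ≡ ∑ xs f ∙ ∑ xs g
  ∑-∙ []       f g = sym (identityˡ ε)
  ∑-∙ (x ∷ xs) f g = trans (cong ((f x ∙ g x) ∙_) (∑-∙ xs f g)) (interchange _ _ _ _)

  ∑-comm : (xs : List B) (ys : List C) (f : B → C → A) →
           ∑[ x ← xs ] ∑[ y ← ys ] f x y ≡ ∑[ y ← ys ] ∑[ x ← xs ] f x y
  ∑-comm []       ys f = sym (∑-ε ys)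
  ∑-comm (x ∷ xs) ys f = trans (cong (∑ ys (f x) ∙_) (∑-comm xs ys f)) (sym (∑-∙ ys (f x) _))

  ∑-cartesianProductWith : (c : B → C → D) (xs : List B) (ys : List C) (f : D → A) →
    ∑ (cartesianProductWith c xs ys) f ≡ ∑[ x ← xs ] ∑[ y ← ys ] f (c x y)
  ∑-cartesianProductWith c []       ys f = refl
  ∑-cartesianProductWith c (x ∷ xs) ys f =
    trans (∑-++ (map (c x) ys) _ f) (cong₂ _∙_ (∑-map (c x) ys f) (∑-cartesianProductWith c xs ys f))

  module _ (_≟_ : DecidableEquality B) where

    remove : B → List B → List B
    remove x = filter (λ y → ¬? (y ≟ x))

    ∑-remove : ∀ {x} (xs : List B) f → Unique xs → x ∈ xs → ∑ xs f ≡ f x ∙ ∑ (remove x xs) f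
    ∑-remove (y ∷ ys) f (y∉ys ∷ !ys) (here refl) = cong (λ l → f y ∙ ∑ l f) (sym removed)
      where
      removed : remove y (y ∷ ys) ≡ ys
      removed = trans (filter-reject (λ z → ¬? (z ≟ y)) (λ y≢y → y≢y refl))
                      (filter-all (λ z → ¬? (z ≟ y)) (All.map (λ y≢z z≡y → y≢z (sym z≡y)) y∉ys))
    ∑-remove {x} (y ∷ ys) f (y∉ys ∷ !ys) (there x∈ys) = begin
      f y ∙ ∑ ys f                     ≡⟨ cong (f y ∙_) (∑-remove ys f !ys x∈ys) ⟩
      f y ∙ (f x ∙ ∑ (remove x ys) f)  ≡⟨ x∙yz≈y∙xz _ _ _ ⟩
      f x ∙ (f y ∙ ∑ (remove x ys) f)  ≡⟨ cong (λ l → f x ∙ ∑ l f) (sym (filter-accept (λ z → ¬? (z ≟ x)) y≢x)) ⟩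
      f x ∙ ∑ (remove x (y ∷ ys)) f    ∎
      where
      open ≡-Reasoning
      y≢x : y ≢ x
      y≢x = All.lookup y∉ys x∈ys

    ∑-sameElements : (xs ys : List B) (f : B → A) → Unique xs → Unique ys →
      (∀ {z} → z ∈ xs → z ∈ ys) → (∀ {z} → z ∈ ys → z ∈ xs) → ∑ xs f ≡ ∑ ys f
    ∑-sameElements [] [] f _ _ _ _ = refl
    ∑-sameElements [] (y ∷ ys) f _ _ _ ys⊆xs with () ← ys⊆xs (here refl)
    ∑-sameElements (x ∷ xs) ys f (x∉xs ∷ !xs) !ys xs⊆ys ys⊆xs =
      trans (cong (f x ∙_) (∑-sameElements xs (remove x ys) f !xs (Unique.filter⁺ _ !ys) xs⊆ys′ ys′⊆xs))
            (sym (∑-remove ys f !ys (xs⊆ys (here refl))))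
      where
      xs⊆ys′ : ∀ {z} → z ∈ xs → z ∈ remove x ys
      xs⊆ys′ z∈xs = ∈-filter⁺ (λ y → ¬? (y ≟ x)) (xs⊆ys (there z∈xs)) (λ z≡x → All.lookup x∉xs z∈xs (sym z≡x))
      ys′⊆xs : ∀ {z} → z ∈ remove x ys → z ∈ xs
      ys′⊆xs z∈ with ∈-filter⁻ (λ y → ¬? (y ≟ x)) {xs = ys} z∈
      ... | z∈ys , z≢x with ys⊆xs z∈ys
      ...   | here z≡x  = ⊥-elim (z≢x z≡x)
      ...   | there z∈xs = z∈xs

    ∑-reindex : (xs : List B) (g g⁻¹ : B → B) (f : B → A) → Unique xs →
      (∀ {z} → z ∈ xs → g z ∈ xs) → (∀ {z} → z ∈ xs → g⁻¹ z ∈ xs) →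
      (∀ z → g (g⁻¹ z) ≡ z) → (∀ z → g⁻¹ (g z) ≡ z) → ∑ xs (f ∘ g) ≡ ∑ xs f
    ∑-reindex xs g g⁻¹ f !xs g-closed g⁻¹-closed g∘g⁻¹ g⁻¹∘g =
      trans (sym (∑-map g xs f)) (∑-sameElements (map g xs) xs f (Unique.map⁺ g-injective !xs) !xs image⊆ ⊆image)
      where
      g-injective : ∀ {x y} → g x ≡ g y → x ≡ y
      g-injective {x} {y} gx≡gy = trans (sym (g⁻¹∘g x)) (trans (cong g⁻¹ gx≡gy) (g⁻¹∘g y))
      image⊆ : ∀ {z} → z ∈ map g xs → z ∈ xs
      image⊆ z∈ with ∈-map⁻ g z∈
      ... | y , y∈xs , refl = g-closed y∈xs
      ⊆image : ∀ {z} → z ∈ xs → z ∈ map g xs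
      ⊆image {z} z∈xs = subst (_∈ map g xs) (g∘g⁻¹ z) (∈-map⁺ g (g⁻¹-closed z∈xs))

    ∑-singleSupport : ∀ {x₀} (xs : List B) f → Unique xs → x₀ ∈ xs →
      (∀ {x} → x ∈ xs → x ≢ x₀ → f x ≡ ε) → ∑ xs f ≡ f x₀
    ∑-singleSupport {x₀} xs f !xs x₀∈xs vanish = begin
      ∑ xs f                      ≡⟨ ∑-remove xs f !xs x₀∈xs ⟩
      f x₀ ∙ ∑ (remove x₀ xs) f   ≡⟨ cong (f x₀ ∙_) (∑-cong (remove x₀ xs) vanish′) ⟩
      f x₀ ∙ (∑[ _ ← remove x₀ xs ] ε) ≡⟨ cong (f x₀ ∙_) (∑-ε (remove x₀ xs)) ⟩
      f x₀ ∙ ε                    ≡⟨ identityʳ (f x₀) ⟩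
      f x₀                        ∎
      where
      open ≡-Reasoning
      vanish′ : ∀ {x} → x ∈ remove x₀ xs → f x ≡ ε
      vanish′ x∈ = let x∈xs , x≢x₀ = ∈-filter⁻ (λ y → ¬? (y ≟ x₀)) {xs = xs} x∈ in vanish x∈xs x≢x₀

i≡-i⇒i≡0 : ∀ {i} → i ≡ - i → i ≡ + 0
i≡-i⇒i≡0 {+ zero} _ = refl

suc[n∸1]≡n : ∀ {n} → 1 ≤ n → suc (n ∸ 1) ≡ n
suc[n∸1]≡n (s≤s _) = refl

open ListSum ℤ.+-0-isCommutativeMonoid

𝟙 : {P : Set} → Dec P → ℤ
𝟙 P? = if does P? then + 1 else + 0

module _ {B : Set} where

  *-distribˡ-∑ : (c : ℤ) (xs : List B) (f : B → ℤ) → c * ∑ xs f ≡ ∑[ x ← xs ] (c * f x)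
  *-distribˡ-∑ c []       f = ℤ.*-zeroʳ c
  *-distribˡ-∑ c (x ∷ xs) f = trans (ℤ.*-distribˡ-+ c (f x) (∑ xs f)) (cong (_+_ (c * f x)) (*-distribˡ-∑ c xs f))

  *-distribʳ-∑ : (c : ℤ) (xs : List B) (f : B → ℤ) → ∑ xs f * c ≡ ∑[ x ← xs ] (f x * c)
  *-distribʳ-∑ c xs f = trans (ℤ.*-comm (∑ xs f) c)
    (trans (*-distribˡ-∑ c xs f) (∑-cong xs (λ {x} _ → ℤ.*-comm c (f x))))

  ∑-const : (xs : List B) (c : ℤ) → ∑[ _ ← xs ] c ≡ + length xs * c
  ∑-const []       c = sym (ℤ.*-zeroˡ c)
  ∑-const (x ∷ xs) c = trans (cong (_+_ c) (∑-const xs c)) (lemma c (+ length xs))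
    where
    lemma : ∀ c n → c + n * c ≡ (+ 1 + n) * c
    lemma = solve-∀

  ∑-1 : (xs : List B) → ∑[ _ ← xs ] + 1 ≡ + length xs
  ∑-1 []       = refl
  ∑-1 (x ∷ xs) = cong (_+_ (+ 1)) (∑-1 xs)

  length-filter : {P : Pred B _} (P? : (x : B) → Dec (P x)) (xs : List B) →
                  + length (filter P? xs) ≡ ∑[ x ← xs ] 𝟙 (P? x)
  length-filter P? []       = refl
  length-filter P? (x ∷ xs) with P? x
  ... | yes _ = cong (_+_ (+ 1)) (length-filter P? xs)
  ... | no  _ = trans (length-filter P? xs) (sym (ℤ.+-identityˡ _))

module FieldProperties {q : ℕ} (K : FiniteField q) where
  open FiniteField K public
    using (F; 0#; 1#; 0≢1; inv; inv-r; _≟_; elems; complete; unique; card)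
    renaming (_+_ to infixl 6 _⊕_; _*_ to infixl 7 _⊗_; -_ to infix 8 ⊝_)

  commutativeRing : CommutativeRing 0ℓ 0ℓ
  commutativeRing = record { isCommutativeRing = FiniteField.isCommutativeRing K }

  open CommutativeRing commutativeRing public
    using ( +-assoc; +-comm; +-identityˡ; +-identityʳ; -‿inverseʳ
          ; *-assoc; *-comm; *-identityˡ; *-identityʳ; zeroˡ; zeroʳ
          ; *-isCommutativeMonoid; commutativeSemiring)
  open import Algebra.Properties.CommutativeSemiring.Exp commutativeSemiring public
    using (^-homo-*; ^-distrib-*; ^-assocʳ) renaming (_^_ to infixr 8 _^ᶠ_)
  open import Algebra.Properties.Ring (CommutativeRing.ring commutativeRing) public
    using (-1*x≈-x; -‿involutive; +-cancelˡ; x∙y⁻¹≈ε⇒x≈y)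
  open import Algebra.Solver.Ring.NaturalCoefficients.Default commutativeSemiring public
    using (solve; _:+_; _:*_; _:=_; con)

  1≢0 : 1# ≢ 0#
  1≢0 1≡0 = 0≢1 (sym 1≡0)

  inv-l : ∀ {x} → x ≢ 0# → inv x ⊗ x ≡ 1#
  inv-l {x} x≢0 = trans (*-comm (inv x) x) (inv-r x x≢0)

  x⊗[x⁻¹⊗z]≡z : ∀ {x} → x ≢ 0# → ∀ z → x ⊗ (inv x ⊗ z) ≡ z
  x⊗[x⁻¹⊗z]≡z {x} x≢0 z = trans (sym (*-assoc x (inv x) z)) (trans (cong (_⊗ z) (inv-r x x≢0)) (*-identityˡ z))

  x⁻¹⊗[x⊗z]≡z : ∀ {x} → x ≢ 0# → ∀ z → inv x ⊗ (x ⊗ z) ≡ z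
  x⁻¹⊗[x⊗z]≡z {x} x≢0 z = trans (sym (*-assoc (inv x) x z)) (trans (cong (_⊗ z) (inv-l x≢0)) (*-identityˡ z))

  ⊗-cancelˡ : ∀ {x y z} → x ≢ 0# → x ⊗ y ≡ x ⊗ z → y ≡ z
  ⊗-cancelˡ {x} {y} {z} x≢0 xy≡xz =
    trans (sym (x⁻¹⊗[x⊗z]≡z x≢0 y)) (trans (cong (inv x ⊗_) xy≡xz) (x⁻¹⊗[x⊗z]≡z x≢0 z))

  x⊗y≡0⇒x≡0⊎y≡0 : ∀ {x y} → x ⊗ y ≡ 0# → x ≡ 0# ⊎ y ≡ 0#
  x⊗y≡0⇒x≡0⊎y≡0 {x} {y} xy≡0 with x ≟ 0#
  ... | yes x≡0 = inj₁ x≡0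
  ... | no  x≢0 = inj₂ (⊗-cancelˡ x≢0 (trans xy≡0 (sym (zeroʳ x))))

  ⊗-≢0 : ∀ {x y} → x ≢ 0# → y ≢ 0# → x ⊗ y ≢ 0#
  ⊗-≢0 x≢0 y≢0 xy≡0 with x⊗y≡0⇒x≡0⊎y≡0 xy≡0
  ... | inj₁ x≡0 = x≢0 x≡0
  ... | inj₂ y≡0 = y≢0 y≡0

  ^ᶠ-≢0 : ∀ {x} n → x ≢ 0# → x ^ᶠ n ≢ 0#
  ^ᶠ-≢0 zero    x≢0 = 1≢0
  ^ᶠ-≢0 (suc n) x≢0 = ⊗-≢0 x≢0 (^ᶠ-≢0 n x≢0)

  inv-≢0 : ∀ {x} → x ≢ 0# → inv x ≢ 0#
  inv-≢0 {x} x≢0 inv≡0 = 1≢0 (trans (sym (inv-r x x≢0)) (trans (cong (x ⊗_) inv≡0) (zeroʳ x)))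

  inv-unique : ∀ {x y} → x ≢ 0# → x ⊗ y ≡ 1# → inv x ≡ y
  inv-unique {x} {y} x≢0 xy≡1 = ⊗-cancelˡ x≢0 (trans (inv-r x x≢0) (sym xy≡1))

  inv-involutive : ∀ {x} → x ≢ 0# → inv (inv x) ≡ x
  inv-involutive x≢0 = inv-unique (inv-≢0 x≢0) (inv-l x≢0)

  inv-distrib-⊗ : ∀ {x y} → x ≢ 0# → y ≢ 0# → inv (x ⊗ y) ≡ inv x ⊗ inv y
  inv-distrib-⊗ {x} {y} x≢0 y≢0 = inv-unique (⊗-≢0 x≢0 y≢0) (begin
    x ⊗ y ⊗ (inv x ⊗ inv y)       ≡⟨ solve 4 (λ x y x′ y′ → x :* y :* (x′ :* y′) := x :* x′ :* (y :* y′)) refl x y (inv x) (inv y) ⟩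
    x ⊗ inv x ⊗ (y ⊗ inv y)       ≡⟨ cong₂ _⊗_ (inv-r x x≢0) (inv-r y y≢0) ⟩
    1# ⊗ 1#                       ≡⟨ *-identityˡ 1# ⟩
    1#                            ∎)
    where open ≡-Reasoning

  inv-1 : inv 1# ≡ 1#
  inv-1 = inv-unique 1≢0 (*-identityˡ 1#)

  x⊗w⊗[w⊗y]⁻¹≡x⊗y⁻¹ : ∀ x {w y} → w ≢ 0# → y ≢ 0# → x ⊗ w ⊗ inv (w ⊗ y) ≡ x ⊗ inv y
  x⊗w⊗[w⊗y]⁻¹≡x⊗y⁻¹ x {w} {y} w≢0 y≢0 = begin
    x ⊗ w ⊗ inv (w ⊗ y)       ≡⟨ cong (x ⊗ w ⊗_) (inv-distrib-⊗ w≢0 y≢0) ⟩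
    x ⊗ w ⊗ (inv w ⊗ inv y)   ≡⟨ solve 4 (λ x w w′ y′ → x :* w :* (w′ :* y′) := x :* (w :* w′) :* y′) refl x w (inv w) (inv y) ⟩
    x ⊗ (w ⊗ inv w) ⊗ inv y   ≡⟨ cong (λ t → x ⊗ t ⊗ inv y) (inv-r w w≢0) ⟩
    x ⊗ 1# ⊗ inv y            ≡⟨ cong (_⊗ inv y) (*-identityʳ x) ⟩
    x ⊗ inv y                 ∎
    where open ≡-Reasoning

  x⊗y⊗y⁻¹≡x : ∀ x {y} → y ≢ 0# → x ⊗ y ⊗ inv y ≡ x
  x⊗y⊗y⁻¹≡x x {y} y≢0 = trans (*-assoc x y (inv y)) (trans (cong (x ⊗_) (inv-r y y≢0)) (*-identityʳ x))

  ∈-units⁺ : ∀ {x} → x ≢ 0# → x ∈ units K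
  ∈-units⁺ {x} x≢0 = ∈-filter⁺ (λ y → ¬? (y ≟ 0#)) (complete x) x≢0

  ∈-units⁻ : ∀ {x} → x ∈ units K → x ≢ 0#
  ∈-units⁻ x∈ = proj₂ (∈-filter⁻ (λ y → ¬? (y ≟ 0#)) {xs = elems} x∈)

  units-unique : Unique (units K)
  units-unique = Unique.filter⁺ _ unique

  ∑-elements : (f : F → ℤ) → ∑ elems f ≡ f 0# + ∑ (units K) f
  ∑-elements f = ∑-sameElements _≟_ elems (0# ∷ units K) f unique (0∉units ∷ units-unique) ⊆ (λ _ → complete _)
    where
    0∉units : All (0# ≢_) (units K)
    0∉units = All.tabulate (λ x∈ 0≡x → ∈-units⁻ x∈ (sym 0≡x))
    ⊆ : ∀ {z} → z ∈ elems → z ∈ 0# ∷ units K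
    ⊆ {z} _ with z ≟ 0#
    ... | yes refl = here refl
    ... | no  z≢0  = there (∈-units⁺ z≢0)

  suc-length-units : suc (length (units K)) ≡ q
  suc-length-units = ℤ.+-injective (begin
    + suc (length (units K))        ≡⟨ cong (_+_ (+ 1)) (sym (∑-1 (units K))) ⟩
    + 1 + (∑[ _ ← units K ] + 1)    ≡⟨ sym (∑-elements (λ _ → + 1)) ⟩
    ∑[ _ ← elems ] + 1              ≡⟨ ∑-1 elems ⟩
    + length elems                  ≡⟨ cong +_ card ⟩
    + q                             ∎)
    where open ≡-Reasoning

  module _ where
    open ListSum *-isCommutativeMonoid using () renaming (∑ to ∏; ∑-reindex to ∏-reindex)

    ∏-scale : ∀ x xs → ∏ xs (x ⊗_) ≡ x ^ᶠ length xs ⊗ ∏ xs id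
    ∏-scale x []       = sym (*-identityˡ 1#)
    ∏-scale x (y ∷ ys) = trans (cong (x ⊗ y ⊗_) (∏-scale x ys))
      (solve 4 (λ x y xⁿ p → x :* y :* (xⁿ :* p) := x :* xⁿ :* (y :* p)) refl x y (x ^ᶠ length ys) (∏ ys id))

    ∏-≢0 : ∀ {xs} → All (_≢ 0#) xs → ∏ xs id ≢ 0#
    ∏-≢0 []             = 1≢0
    ∏-≢0 (x≢0 ∷ xs≢0) = ⊗-≢0 x≢0 (∏-≢0 xs≢0)

    -- Multiplication by x permutes the units, so it fixes their product.
    ^ᶠ-length-units : ∀ {x} → x ≢ 0# → x ^ᶠ length (units K) ≡ 1#
    ^ᶠ-length-units {x} x≢0 = ⊗-cancelˡ (∏-≢0 units≢0) (begin
      P ⊗ x ^ᶠ length (units K)   ≡⟨ *-comm P _ ⟩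
      x ^ᶠ length (units K) ⊗ P   ≡⟨ sym (∏-scale x (units K)) ⟩
      ∏ (units K) (x ⊗_)          ≡⟨ ∏-reindex _≟_ (units K) (x ⊗_) (inv x ⊗_) id units-unique
                                       (λ z∈ → ∈-units⁺ (⊗-≢0 x≢0 (∈-units⁻ z∈)))
                                       (λ z∈ → ∈-units⁺ (⊗-≢0 (inv-≢0 x≢0) (∈-units⁻ z∈)))
                                       (x⊗[x⁻¹⊗z]≡z x≢0) (x⁻¹⊗[x⊗z]≡z x≢0) ⟩
      P                           ≡⟨ sym (*-identityʳ P) ⟩
      P ⊗ 1#                      ∎)
      where
      open ≡-Reasoning
      P = ∏ (units K) id
      units≢0 : All (_≢ 0#) (units K)
      units≢0 = All.tabulate ∈-units⁻

  fermat : ∀ x → x ^ᶠ q ≡ x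
  fermat x with x ≟ 0#
  ... | yes refl = subst (λ n → 0# ^ᶠ n ≡ 0#) suc-length-units (zeroˡ _)
  ... | no  x≢0  = subst (λ n → x ^ᶠ n ≡ x) suc-length-units
                     (trans (cong (x ⊗_) (^ᶠ-length-units x≢0)) (*-identityʳ x))

  a⊕[z⊖a]≡z : ∀ a z → a ⊕ (z ⊕ ⊝ a) ≡ z
  a⊕[z⊖a]≡z a z = begin
    a ⊕ (z ⊕ ⊝ a)   ≡⟨ sym (+-assoc a z (⊝ a)) ⟩
    a ⊕ z ⊕ ⊝ a     ≡⟨ cong (_⊕ ⊝ a) (+-comm a z) ⟩
    z ⊕ a ⊕ ⊝ a     ≡⟨ +-assoc z a (⊝ a) ⟩
    z ⊕ (a ⊕ ⊝ a)   ≡⟨ cong (z ⊕_) (-‿inverseʳ a) ⟩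
    z ⊕ 0#          ≡⟨ +-identityʳ z ⟩
    z               ∎
    where open ≡-Reasoning

  eval : List F → F → F
  eval []       x = 0#
  eval (c ∷ cs) x = c ⊕ x ⊗ eval cs x

  -- Synthetic division: quotient a cs is the quotient of c ∷ cs by X - a, for every c.
  quotient : F → List F → List F
  quotient a []       = []
  quotient a (c ∷ cs) = eval (c ∷ cs) a ∷ quotient a cs

  length-quotient : ∀ a cs → length (quotient a cs) ≡ length cs
  length-quotient a []       = refl
  length-quotient a (c ∷ cs) = cong suc (length-quotient a cs)

  eval-quotient : ∀ a d c cs → eval (c ∷ cs) (a ⊕ d) ≡ eval (c ∷ cs) a ⊕ d ⊗ eval (quotient a cs) (a ⊕ d)
  eval-quotient a d c [] =
    solve 3 (λ a d c → c :+ (a :+ d) :* con 0 := c :+ a :* con 0 :+ d :* con 0) refl a d c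
  eval-quotient a d c (c′ ∷ cs) = begin
    c ⊕ (a ⊕ d) ⊗ eval (c′ ∷ cs) (a ⊕ d)  ≡⟨ cong (λ e → c ⊕ (a ⊕ d) ⊗ e) (eval-quotient a d c′ cs) ⟩
    c ⊕ (a ⊕ d) ⊗ (e ⊕ d ⊗ r)             ≡⟨ solve 5 (λ a d c e r → c :+ (a :+ d) :* (e :+ d :* r)
                                                         := c :+ a :* e :+ d :* (e :+ (a :+ d) :* r)) refl a d c e r ⟩
    c ⊕ a ⊗ e ⊕ d ⊗ (e ⊕ (a ⊕ d) ⊗ r)     ∎
    where
    open ≡-Reasoning
    e = eval (c′ ∷ cs) a
    r = eval (quotient a cs) (a ⊕ d)

  eval-quotient′ : ∀ a z c cs → eval (c ∷ cs) z ≡ eval (c ∷ cs) a ⊕ (z ⊕ ⊝ a) ⊗ eval (quotient a cs) z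
  eval-quotient′ a z c cs = subst (λ x → eval (c ∷ cs) x ≡ eval (c ∷ cs) a ⊕ (z ⊕ ⊝ a) ⊗ eval (quotient a cs) x)
                                  (a⊕[z⊖a]≡z a z) (eval-quotient a (z ⊕ ⊝ a) c cs)

  eval-zero : ∀ {cs} x → All (_≡ 0#) cs → eval cs x ≡ 0#
  eval-zero x []                = refl
  eval-zero x (refl ∷ cs≡0) = trans (cong (λ e → 0# ⊕ x ⊗ e) (eval-zero x cs≡0))
                                     (trans (+-identityˡ _) (zeroʳ x))

  head-zero : ∀ {c cs} x → eval (c ∷ cs) x ≡ 0# → All (_≡ 0#) cs → c ≡ 0#
  head-zero {c} x p≡0 cs≡0 =
    trans (sym (trans (cong (λ e → c ⊕ x ⊗ e) (eval-zero x cs≡0)) (trans (cong (c ⊕_) (zeroʳ x)) (+-identityʳ c)))) p≡0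

  quotient-zero : ∀ a cs → All (_≡ 0#) (quotient a cs) → All (_≡ 0#) cs
  quotient-zero a []       []              = []
  quotient-zero a (c ∷ cs) (p≡0 ∷ q≡0) = head-zero a p≡0 cs≡0 ∷ cs≡0
    where cs≡0 = quotient-zero a cs q≡0

  vanishing-polynomial : (zs p : List F) → Unique zs → length p ≤ length zs →
    (∀ {z} → z ∈ zs → eval p z ≡ 0#) → All (_≡ 0#) p
  vanishing-polynomial zs       []       _ _ _ = []
  vanishing-polynomial (a ∷ zs) (c ∷ cs) (a∉zs ∷ !zs) (s≤s |cs|≤|zs|) vanish =
    head-zero a p[a]≡0 cs≡0 ∷ cs≡0
    where
    p[a]≡0 = vanish (here refl)
    quotient-vanishes : ∀ {z} → z ∈ zs → eval (quotient a cs) z ≡ 0#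
    quotient-vanishes {z} z∈zs with x⊗y≡0⇒x≡0⊎y≡0 [z⊖a]⊗q[z]≡0
      where
      [z⊖a]⊗q[z]≡0 : (z ⊕ ⊝ a) ⊗ eval (quotient a cs) z ≡ 0#
      [z⊖a]⊗q[z]≡0 = trans (sym (+-identityˡ _)) (trans (cong (_⊕ (z ⊕ ⊝ a) ⊗ eval (quotient a cs) z) (sym p[a]≡0))
                       (trans (sym (eval-quotient′ a z c cs)) (vanish (there z∈zs))))
    ... | inj₁ z⊖a≡0  = ⊥-elim (All.lookup a∉zs z∈zs (sym (x∙y⁻¹≈ε⇒x≈y z a z⊖a≡0)))
    ... | inj₂ q[z]≡0 = q[z]≡0
    cs≡0 : All (_≡ 0#) cs
    cs≡0 = quotient-zero a cs (vanishing-polynomial zs (quotient a cs) !zs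
             (subst (_≤ length zs) (sym (length-quotient a cs)) |cs|≤|zs|) quotient-vanishes)

  infixl 6 _⊞_
  _⊞_ : List F → List F → List F
  []       ⊞ q        = q
  (c ∷ cs) ⊞ []       = c ∷ cs
  (c ∷ cs) ⊞ (d ∷ ds) = c ⊕ d ∷ cs ⊞ ds

  eval-⊞ : ∀ p q x → eval (p ⊞ q) x ≡ eval p x ⊕ eval q x
  eval-⊞ []       q        x = sym (+-identityˡ _)
  eval-⊞ (c ∷ cs) []       x = sym (+-identityʳ _)
  eval-⊞ (c ∷ cs) (d ∷ ds) x = trans (cong (λ e → c ⊕ d ⊕ x ⊗ e) (eval-⊞ cs ds x))
    (solve 5 (λ c d x p q → c :+ d :+ x :* (p :+ q) := c :+ x :* p :+ (d :+ x :* q)) refl c d x (eval cs x) (eval ds x))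

  length-⊞ : ∀ p q → length p ≤ length q → length (p ⊞ q) ≡ length q
  length-⊞ []       q        _           = refl
  length-⊞ (c ∷ cs) (d ∷ ds) (s≤s |cs|≤|ds|) = cong suc (length-⊞ cs ds |cs|≤|ds|)

  X^ : ℕ → List F
  X^ zero    = 1# ∷ []
  X^ (suc k) = 0# ∷ X^ k

  eval-X^ : ∀ k x → eval (X^ k) x ≡ x ^ᶠ k
  eval-X^ zero    x = trans (cong (1# ⊕_) (zeroʳ x)) (+-identityʳ 1#)
  eval-X^ (suc k) x = trans (+-identityˡ _) (cong (x ⊗_) (eval-X^ k x))

  length-X^ : ∀ k → length (X^ k) ≡ suc k
  length-X^ zero    = refl
  length-X^ (suc k) = cong suc (length-X^ k)

  -- Adding X^k to a polynomial of degree below k leaves the coefficient 1 at X^k.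
  ⊞-X^-≢0 : ∀ k p → length p ≤ k → ¬ All (_≡ 0#) (p ⊞ X^ k)
  ⊞-X^-≢0 zero    []       _               (1≡0 ∷ _) = 1≢0 1≡0
  ⊞-X^-≢0 (suc k) []       _               (_ ∷ p≡0) = ⊞-X^-≢0 k [] z≤n p≡0
  ⊞-X^-≢0 (suc k) (c ∷ cs) (s≤s |cs|≤k)   (_ ∷ p≡0) = ⊞-X^-≢0 k cs |cs|≤k p≡0


module CharacteristicTwo (r : ℕ) (K : FiniteField (2 ^ r)) (1≤r : 1 ≤ r) where
  open FieldProperties K public

  1^ᶠ : ∀ n → 1# ^ᶠ n ≡ 1#
  1^ᶠ zero    = refl
  1^ᶠ (suc n) = trans (*-identityˡ _) (1^ᶠ n)

  -- Fermat applied to -1 at the even exponent q.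
  ⊝1≡1 : ⊝ 1# ≡ 1#
  ⊝1≡1 = begin
    ⊝ 1#                          ≡⟨ sym (fermat (⊝ 1#)) ⟩
    (⊝ 1#) ^ᶠ (2 ^ r)             ≡⟨ cong (λ n → (⊝ 1#) ^ᶠ (2 ^ n)) (sym (suc[n∸1]≡n 1≤r)) ⟩
    (⊝ 1#) ^ᶠ (2 ℕ.* 2 ^ (r ∸ 1)) ≡⟨ sym (^-assocʳ (⊝ 1#) 2 (2 ^ (r ∸ 1))) ⟩
    ((⊝ 1#) ^ᶠ 2) ^ᶠ 2 ^ (r ∸ 1)   ≡⟨ cong (_^ᶠ 2 ^ (r ∸ 1)) [⊝1]²≡1 ⟩
    1# ^ᶠ 2 ^ (r ∸ 1)             ≡⟨ 1^ᶠ (2 ^ (r ∸ 1)) ⟩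
    1#                            ∎
    where
    open ≡-Reasoning
    [⊝1]²≡1 : (⊝ 1#) ^ᶠ 2 ≡ 1#
    [⊝1]²≡1 = trans (cong (⊝ 1# ⊗_) (*-identityʳ (⊝ 1#))) (trans (-1*x≈-x (⊝ 1#)) (-‿involutive 1#))

  ⊝-self : ∀ x → ⊝ x ≡ x
  ⊝-self x = trans (sym (-1*x≈-x x)) (trans (cong (_⊗ x) ⊝1≡1) (*-identityˡ x))

  x⊕x≡0 : ∀ x → x ⊕ x ≡ 0#
  x⊕x≡0 x = trans (cong (x ⊕_) (sym (⊝-self x))) (-‿inverseʳ x)

  x⊕y≡0⇒x≡y : ∀ {x y} → x ⊕ y ≡ 0# → x ≡ y
  x⊕y≡0⇒x≡y {x} {y} x⊕y≡0 = x∙y⁻¹≈ε⇒x≈y x y (trans (cong (x ⊕_) (⊝-self y)) x⊕y≡0)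

  sq : F → F
  sq x = x ⊗ x

  sq-⊕ : ∀ x y → sq (x ⊕ y) ≡ sq x ⊕ sq y
  sq-⊕ x y = begin
    (x ⊕ y) ⊗ (x ⊕ y)                 ≡⟨ solve 2 (λ x y → (x :+ y) :* (x :+ y) := x :* x :+ y :* y :+ (x :* y :+ x :* y)) refl x y ⟩
    x ⊗ x ⊕ y ⊗ y ⊕ (x ⊗ y ⊕ x ⊗ y)   ≡⟨ cong (x ⊗ x ⊕ y ⊗ y ⊕_) (x⊕x≡0 (x ⊗ y)) ⟩
    x ⊗ x ⊕ y ⊗ y ⊕ 0#                ≡⟨ +-identityʳ _ ⟩
    x ⊗ x ⊕ y ⊗ y                     ∎
    where open ≡-Reasoning

  sq-⊗ : ∀ x y → sq (x ⊗ y) ≡ sq x ⊗ sq y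
  sq-⊗ = solve 2 (λ x y → x :* y :* (x :* y) := x :* x :* (y :* y)) refl

  sqIter-sq : ∀ i x → sqIter K i (sq x) ≡ sq (sqIter K i x)
  sqIter-sq zero    x = refl
  sqIter-sq (suc i) x = sqIter-sq i (sq x)

  sqIter-⊕ : ∀ i x y → sqIter K i (x ⊕ y) ≡ sqIter K i x ⊕ sqIter K i y
  sqIter-⊕ zero    x y = refl
  sqIter-⊕ (suc i) x y = trans (cong (sqIter K i) (sq-⊕ x y)) (sqIter-⊕ i (sq x) (sq y))

  sqIter-⊗ : ∀ i x y → sqIter K i (x ⊗ y) ≡ sqIter K i x ⊗ sqIter K i y
  sqIter-⊗ zero    x y = refl
  sqIter-⊗ (suc i) x y = trans (cong (sqIter K i) (sq-⊗ x y)) (sqIter-⊗ i (sq x) (sq y))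

  sqIter-0 : ∀ i → sqIter K i 0# ≡ 0#
  sqIter-0 zero    = refl
  sqIter-0 (suc i) = trans (cong (sqIter K i) (zeroˡ 0#)) (sqIter-0 i)

  sqIter-1 : ∀ i → sqIter K i 1# ≡ 1#
  sqIter-1 zero    = refl
  sqIter-1 (suc i) = trans (cong (sqIter K i) (*-identityˡ 1#)) (sqIter-1 i)

  sqIter-^ᶠ : ∀ i x → sqIter K i x ≡ x ^ᶠ 2 ^ i
  sqIter-^ᶠ zero    x = sym (*-identityʳ x)
  sqIter-^ᶠ (suc i) x = begin
    sqIter K i (x ⊗ x)             ≡⟨ sqIter-^ᶠ i (x ⊗ x) ⟩
    (x ⊗ x) ^ᶠ 2 ^ i               ≡⟨ ^-distrib-* x x (2 ^ i) ⟩
    x ^ᶠ 2 ^ i ⊗ x ^ᶠ 2 ^ i        ≡⟨ sym (^-homo-* x (2 ^ i) (2 ^ i)) ⟩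
    x ^ᶠ (2 ^ i ℕ.+ 2 ^ i)         ≡⟨ cong (λ n → x ^ᶠ (2 ^ i ℕ.+ n)) (sym (ℕ.+-identityʳ (2 ^ i))) ⟩
    x ^ᶠ 2 ^ suc i                 ∎
    where open ≡-Reasoning

  sqIter-r : ∀ x → sqIter K r x ≡ x
  sqIter-r x = trans (sqIter-^ᶠ r x) (fermat x)

  sqIter-≢0 : ∀ i {x} → x ≢ 0# → sqIter K i x ≢ 0#
  sqIter-≢0 i {x} x≢0 = ^ᶠ-≢0 (2 ^ i) x≢0 ∘ trans (sym (sqIter-^ᶠ i x))

  inv-sqIter : ∀ i {x} → x ≢ 0# → inv (sqIter K i x) ≡ sqIter K i (inv x)
  inv-sqIter i {x} x≢0 = inv-unique (sqIter-≢0 i x≢0)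
    (trans (sym (sqIter-⊗ i x (inv x))) (trans (cong (sqIter K i) (inv-r x x≢0)) (sqIter-1 i)))

  sqIter-[r∸1]-sq : ∀ x → sqIter K (r ∸ 1) (sq x) ≡ x
  sqIter-[r∸1]-sq x = trans (cong (λ n → sqIter K n x) (suc[n∸1]≡n 1≤r)) (sqIter-r x)

  sq-sqIter-[r∸1] : ∀ x → sq (sqIter K (r ∸ 1) x) ≡ x
  sq-sqIter-[r∸1] x = trans (sym (sqIter-sq (r ∸ 1) x)) (sqIter-[r∸1]-sq x)

  tr-suc : ∀ i x → tr K (suc i) x ≡ x ⊕ tr K i (sq x)
  tr-suc zero    x = trans (+-identityˡ x) (sym (+-identityʳ x))
  tr-suc (suc i) x = trans (cong (_⊕ sqIter K (suc i) x) (tr-suc i x)) (+-assoc _ _ _)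

  tr-⊕ : ∀ i x y → tr K i (x ⊕ y) ≡ tr K i x ⊕ tr K i y
  tr-⊕ zero    x y = sym (+-identityˡ 0#)
  tr-⊕ (suc i) x y = trans (cong₂ _⊕_ (tr-⊕ i x y) (sqIter-⊕ i x y))
    (solve 4 (λ a b c d → a :+ b :+ (c :+ d) := a :+ c :+ (b :+ d)) refl (tr K i x) (tr K i y) (sqIter K i x) (sqIter K i y))

  tr-sq : ∀ i x → tr K i (sq x) ≡ sq (tr K i x)
  tr-sq zero    x = sym (zeroˡ 0#)
  tr-sq (suc i) x = trans (cong₂ _⊕_ (tr-sq i x) (sqIter-sq i x)) (sym (sq-⊕ _ _))

  tr-0 : ∀ i → tr K i 0# ≡ 0#
  tr-0 zero    = refl
  tr-0 (suc i) = trans (cong₂ _⊕_ (tr-0 i) (sqIter-0 i)) (+-identityʳ 0#)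

  -- tr (suc r) x = tr r x ⊕ x by Fermat, and = x ⊕ tr r (sq x) by tr-suc.
  tr-sq-invariant : ∀ x → tr K r (sq x) ≡ tr K r x
  tr-sq-invariant x = +-cancelˡ x _ _
    (trans (sym (tr-suc r x)) (trans (cong (tr K r x ⊕_) (sqIter-r x)) (+-comm _ _)))

  tr≡0⊎tr≡1 : ∀ x → tr K r x ≡ 0# ⊎ tr K r x ≡ 1#
  tr≡0⊎tr≡1 x with x⊗y≡0⇒x≡0⊎y≡0 t⊗[t⊕1]≡0
    where
    t = tr K r x
    t⊗[t⊕1]≡0 : t ⊗ (t ⊕ 1#) ≡ 0#
    t⊗[t⊕1]≡0 = trans (solve 1 (λ t → t :* (t :+ con 1) := t :* t :+ t) refl t)
                  (trans (cong (_⊕ t) (trans (sym (tr-sq r x)) (tr-sq-invariant x))) (x⊕x≡0 t))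
  ... | inj₁ t≡0   = inj₁ t≡0
  ... | inj₂ t⊕1≡0 = inj₂ (x⊕y≡0⇒x≡y t⊕1≡0)

  trPoly : ℕ → List F
  trPoly zero    = []
  trPoly (suc i) = trPoly i ⊞ X^ (2 ^ i)

  eval-trPoly : ∀ i x → eval (trPoly i) x ≡ tr K i x
  eval-trPoly zero    x = refl
  eval-trPoly (suc i) x = trans (eval-⊞ (trPoly i) (X^ (2 ^ i)) x)
    (cong₂ _⊕_ (eval-trPoly i x) (trans (eval-X^ (2 ^ i) x) (sym (sqIter-^ᶠ i x))))

  length-trPoly : ∀ i → length (trPoly i) ≤ 2 ^ i
  length-trPoly zero    = z≤n
  length-trPoly (suc i) = begin
    length (trPoly i ⊞ X^ (2 ^ i))  ≡⟨ length-⊞ (trPoly i) (X^ (2 ^ i)) shorter ⟩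
    length (X^ (2 ^ i))             ≡⟨ length-X^ (2 ^ i) ⟩
    1 ℕ.+ 2 ^ i                     ≤⟨ ℕ.+-monoˡ-≤ (2 ^ i) (ℕ.m^n>0 2 i) ⟩
    2 ^ i ℕ.+ 2 ^ i                 ≡⟨ cong (2 ^ i ℕ.+_) (sym (ℕ.+-identityʳ (2 ^ i))) ⟩
    2 ^ suc i                       ∎
    where
    open ℕ.≤-Reasoning
    shorter : length (trPoly i) ≤ length (X^ (2 ^ i))
    shorter = subst (length (trPoly i) ≤_) (sym (length-X^ (2 ^ i))) (ℕ.m≤n⇒m≤1+n (length-trPoly i))

  tr-surjective : Σ[ a ∈ F ] tr K r a ≡ 1#
  tr-surjective with All.all? (λ x → tr K r x ≟ 0#) elems
  ... | yes tr≡0 = ⊥-elim (trPoly-≢0 (vanishing-polynomial elems (trPoly r) unique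
                     (subst (length (trPoly r) ≤_) (sym card) (length-trPoly r))
                     (λ {z} z∈ → trans (eval-trPoly r z) (All.lookup tr≡0 z∈))))
    where
    trPoly-≢0 : ¬ All (_≡ 0#) (trPoly r)
    trPoly-≢0 = subst (λ n → ¬ All (_≡ 0#) (trPoly n)) (suc[n∸1]≡n 1≤r)
                  (⊞-X^-≢0 (2 ^ (r ∸ 1)) (trPoly (r ∸ 1)) (length-trPoly (r ∸ 1)))
  ... | no ¬tr≡0 with satisfied (¬All⇒Any¬ (λ x → tr K r x ≟ 0#) elems ¬tr≡0)
  ...   | a , tr[a]≢0 with tr≡0⊎tr≡1 a
  ...     | inj₁ tr[a]≡0 = ⊥-elim (tr[a]≢0 tr[a]≡0)
  ...     | inj₂ tr[a]≡1 = a , tr[a]≡1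

  χ : F → ℤ
  χ = λχ K r

  -- χ x unfolds to sign (tr K r x).
  sign : F → ℤ
  sign t = if does (t ≟ 0#) then + 1 else -1ℤ

  sign-0 : sign 0# ≡ + 1
  sign-0 with 0# ≟ 0#
  ... | yes _   = refl
  ... | no 0≢0 = ⊥-elim (0≢0 refl)

  sign-1 : sign 1# ≡ -1ℤ
  sign-1 with 1# ≟ 0#
  ... | yes 1≡0 = ⊥-elim (1≢0 1≡0)
  ... | no  _   = refl

  χ-0 : χ 0# ≡ + 1
  χ-0 = trans (cong sign (tr-0 r)) sign-0

  χ-⊕ : ∀ x y → χ (x ⊕ y) ≡ χ x * χ y
  χ-⊕ x y = trans (cong sign (tr-⊕ r x y)) (sign-⊕ (tr≡0⊎tr≡1 x) (tr≡0⊎tr≡1 y))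
    where
    sign-⊕ : ∀ {t u} → t ≡ 0# ⊎ t ≡ 1# → u ≡ 0# ⊎ u ≡ 1# → sign (t ⊕ u) ≡ sign t * sign u
    sign-⊕ (inj₁ refl) (inj₁ refl) = trans (cong sign (+-identityʳ 0#)) (trans sign-0 (cong₂ _*_ (sym sign-0) (sym sign-0)))
    sign-⊕ (inj₁ refl) (inj₂ refl) = trans (cong sign (+-identityˡ 1#)) (trans sign-1 (cong₂ _*_ (sym sign-0) (sym sign-1)))
    sign-⊕ (inj₂ refl) (inj₁ refl) = trans (cong sign (+-identityʳ 1#)) (trans sign-1 (cong₂ _*_ (sym sign-1) (sym sign-0)))
    sign-⊕ (inj₂ refl) (inj₂ refl) = trans (cong sign (x⊕x≡0 1#)) (trans sign-0 (cong₂ _*_ (sym sign-1) (sym sign-1)))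

  χ-sq : ∀ x → χ (sq x) ≡ χ x
  χ-sq x = cong sign (tr-sq-invariant x)

  χ-sqIter : ∀ i x → χ (sqIter K i x) ≡ χ x
  χ-sqIter zero    x = refl
  χ-sqIter (suc i) x = trans (χ-sqIter i (sq x)) (χ-sq x)

  -- Translating by an element of trace 1 flips the sign of the sum.
  ∑χ≡0 : ∑ elems χ ≡ + 0
  ∑χ≡0 = i≡-i⇒i≡0 (begin
    ∑ elems χ                 ≡⟨ sym (∑-reindex _≟_ elems (_⊕ a) (_⊕ a) χ unique (λ _ → complete _) (λ _ → complete _) ⊕a⊕a ⊕a⊕a) ⟩
    ∑[ x ← elems ] χ (x ⊕ a)  ≡⟨ ∑-cong elems (λ {x} _ → trans (χ-⊕ x a) (cong (χ x *_) χ[a]≡-1)) ⟩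
    ∑[ x ← elems ] χ x * -1ℤ  ≡⟨ ∑-cong elems (λ {x} _ → ℤ.*-comm (χ x) -1ℤ) ⟩
    ∑[ x ← elems ] -1ℤ * χ x  ≡⟨ sym (*-distribˡ-∑ -1ℤ elems χ) ⟩
    -1ℤ * ∑ elems χ           ≡⟨ ℤ.-1*i≡-i (∑ elems χ) ⟩
    - ∑ elems χ               ∎)
    where
    open ≡-Reasoning
    a = proj₁ tr-surjective
    χ[a]≡-1 : χ a ≡ -1ℤ
    χ[a]≡-1 = trans (cong sign (proj₂ tr-surjective)) sign-1
    ⊕a⊕a : ∀ x → x ⊕ a ⊕ a ≡ x
    ⊕a⊕a x = trans (+-assoc x a a) (trans (cong (x ⊕_) (x⊕x≡0 a)) (+-identityʳ x))

  ∑-units-χ : ∑ (units K) χ ≡ -1ℤ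
  ∑-units-χ = begin
    ∑ (units K) χ                 ≡⟨ cancel (∑ (units K) χ) ⟩
    -1ℤ + (+ 1 + ∑ (units K) χ)   ≡⟨ cong (λ c → -1ℤ + (c + ∑ (units K) χ)) (sym χ-0) ⟩
    -1ℤ + (χ 0# + ∑ (units K) χ)  ≡⟨ cong (_+_ -1ℤ) (sym (∑-elements χ)) ⟩
    -1ℤ + ∑ elems χ               ≡⟨ cong (_+_ -1ℤ) ∑χ≡0 ⟩
    -1ℤ                           ∎
    where
    open ≡-Reasoning
    cancel : ∀ s → s ≡ -1ℤ + (+ 1 + s)
    cancel = solve-∀

  ψ : F → ℤ
  ψ c = ∑[ x ← elems ] χ (x ⊗ c)

  ψ-0 : ψ 0# ≡ + 2 ^ r
  ψ-0 = trans (∑-cong elems (λ {x} _ → trans (cong χ (zeroʳ x)) χ-0)) (trans (∑-1 elems) (cong +_ card))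

  ψ-≢0 : ∀ {c} → c ≢ 0# → ψ c ≡ + 0
  ψ-≢0 {c} c≢0 = trans (∑-reindex _≟_ elems (_⊗ c) (_⊗ inv c) χ unique (λ _ → complete _) (λ _ → complete _)
    (λ z → trans (*-assoc z _ _) (trans (cong (z ⊗_) (inv-l c≢0)) (*-identityʳ z)))
    (λ z → x⊗y⊗y⁻¹≡x z c≢0)) ∑χ≡0

  ψ≡1+∑units : ∀ c → ψ c ≡ + 1 + (∑[ x ← units K ] χ (x ⊗ c))
  ψ≡1+∑units c = trans (∑-elements (λ x → χ (x ⊗ c))) (cong (_+ (∑[ x ← units K ] χ (x ⊗ c))) (trans (cong χ (zeroˡ c)) χ-0))


module Counting (r : ℕ) (K : FiniteField (2 ^ r)) (1≤r : 1 ≤ r) where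
  open CharacteristicTwo r K 1≤r public

  module _ {g g⁻¹ : F → F} (g∘g⁻¹ : ∀ z → g (g⁻¹ z) ≡ z) (g⁻¹∘g : ∀ z → g⁻¹ (g z) ≡ z) (g[0]≡0 : g 0# ≡ 0#) where

    ∑-units-reindex : (f : F → ℤ) → ∑ (units K) (f ∘ g) ≡ ∑ (units K) f
    ∑-units-reindex f = ∑-reindex _≟_ (units K) g g⁻¹ f units-unique
      (∈-units⁺ ∘ g-≢0 ∘ ∈-units⁻) (∈-units⁺ ∘ g⁻¹-≢0 ∘ ∈-units⁻) g∘g⁻¹ g⁻¹∘g
      where
      g-≢0 : ∀ {z} → z ≢ 0# → g z ≢ 0#
      g-≢0 {z} z≢0 gz≡0 = z≢0 (trans (sym (g⁻¹∘g z)) (trans (cong g⁻¹ (trans gz≡0 (sym g[0]≡0))) (g⁻¹∘g 0#)))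
      g⁻¹-≢0 : ∀ {z} → z ≢ 0# → g⁻¹ z ≢ 0#
      g⁻¹-≢0 {z} z≢0 g⁻¹z≡0 = z≢0 (trans (sym (g∘g⁻¹ z)) (trans (cong g g⁻¹z≡0) g[0]≡0))

    ∑-tuples-map : ∀ m (f : Vec F m → ℤ) → ∑[ v ← tuples K m ] f (Vec.map g v) ≡ ∑ (tuples K m) f
    ∑-tuples-map zero    f = refl
    ∑-tuples-map (suc m) f = begin
      ∑[ v ← tuples K (suc m) ] f (Vec.map g v)                ≡⟨ ∑-cartesianProductWith _∷_ (units K) (tuples K m) _ ⟩
      ∑[ a ← units K ] ∑[ v ← tuples K m ] f (g a ∷ Vec.map g v) ≡⟨ ∑-cong (units K) (λ {a} _ → ∑-tuples-map m (λ v → f (g a ∷ v))) ⟩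
      ∑[ a ← units K ] ∑[ v ← tuples K m ] f (g a ∷ v)           ≡⟨ ∑-units-reindex (λ a → ∑[ v ← tuples K m ] f (a ∷ v)) ⟩
      ∑[ a ← units K ] ∑[ v ← tuples K m ] f (a ∷ v)             ≡⟨ sym (∑-cartesianProductWith _∷_ (units K) (tuples K m) f) ⟩
      ∑ (tuples K (suc m)) f                                     ∎
      where open ≡-Reasoning

  ∑-units-sqIter : ∀ i (f : F → ℤ) → ∑[ x ← units K ] f (sqIter K i x) ≡ ∑ (units K) f
  ∑-units-sqIter zero    f = refl
  ∑-units-sqIter (suc i) f =
    trans (∑-units-reindex sq-sqIter-[r∸1] sqIter-[r∸1]-sq (zeroˡ 0#) (f ∘ sqIter K i)) (∑-units-sqIter i f)

  ∑-tuples-cong : ∀ m {f h : Vec F m → ℤ} → (∀ v → AllV.All (_≢ 0#) v → f v ≡ h v) →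
                  ∑ (tuples K m) f ≡ ∑ (tuples K m) h
  ∑-tuples-cong zero    f≗h = cong (_+ + 0) (f≗h [] [])
  ∑-tuples-cong (suc m) {f} {h} f≗h = begin
    ∑ (tuples K (suc m)) f                          ≡⟨ ∑-cartesianProductWith _∷_ (units K) (tuples K m) f ⟩
    ∑[ a ← units K ] ∑[ v ← tuples K m ] f (a ∷ v)  ≡⟨ ∑-cong (units K) (λ a∈ → ∑-tuples-cong m (λ v v≢0 → f≗h _ (∈-units⁻ a∈ ∷ v≢0))) ⟩
    ∑[ a ← units K ] ∑[ v ← tuples K m ] h (a ∷ v)  ≡⟨ sym (∑-cartesianProductWith _∷_ (units K) (tuples K m) h) ⟩
    ∑ (tuples K (suc m)) h                          ∎
    where open ≡-Reasoning

  length-units : length (units K) ≡ 2 ^ r ∸ 1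
  length-units = cong (_∸ 1) suc-length-units

  ∑-tuples-1 : ∀ m → ∑[ _ ← tuples K m ] + 1 ≡ + (2 ^ r ∸ 1) ^ m
  ∑-tuples-1 zero    = refl
  ∑-tuples-1 (suc m) = begin
    ∑[ _ ← tuples K (suc m) ] + 1                ≡⟨ ∑-cartesianProductWith _∷_ (units K) (tuples K m) _ ⟩
    ∑[ _ ← units K ] ∑[ _ ← tuples K m ] + 1      ≡⟨ ∑-cong (units K) (λ _ → ∑-tuples-1 m) ⟩
    ∑[ _ ← units K ] + (2 ^ r ∸ 1) ^ m           ≡⟨ ∑-const (units K) _ ⟩
    + length (units K) * + (2 ^ r ∸ 1) ^ m       ≡⟨ cong (λ n → + n * + (2 ^ r ∸ 1) ^ m) length-units ⟩
    + (2 ^ r ∸ 1) * + (2 ^ r ∸ 1) ^ m            ≡⟨ sym (ℤ.pos-* (2 ^ r ∸ 1) _) ⟩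
    + (2 ^ r ∸ 1) ^ suc m                        ∎
    where open ≡-Reasoning

  ∑-tuples-χ : ∀ m → ∑[ v ← tuples K m ] χ (vsum K v) ≡ -1ℤ ℤ.^ m
  ∑-tuples-χ zero    = trans (ℤ.+-identityʳ _) χ-0
  ∑-tuples-χ (suc m) = begin
    ∑[ v ← tuples K (suc m) ] χ (vsum K v)                  ≡⟨ ∑-cartesianProductWith _∷_ (units K) (tuples K m) _ ⟩
    ∑[ a ← units K ] ∑[ v ← tuples K m ] χ (a ⊕ vsum K v)    ≡⟨ ∑-cong (units K) (λ {a} _ → ∑-cong (tuples K m) (λ {v} _ → χ-⊕ a (vsum K v))) ⟩
    ∑[ a ← units K ] ∑[ v ← tuples K m ] χ a * χ (vsum K v)  ≡⟨ ∑-cong (units K) (λ {a} _ → sym (*-distribˡ-∑ (χ a) (tuples K m) _)) ⟩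
    ∑[ a ← units K ] χ a * (∑[ v ← tuples K m ] χ (vsum K v)) ≡⟨ ∑-cong (units K) (λ {a} _ → cong (χ a *_) (∑-tuples-χ m)) ⟩
    ∑[ a ← units K ] χ a * (-1ℤ ℤ.^ m)                      ≡⟨ sym (*-distribʳ-∑ _ (units K) χ) ⟩
    ∑ (units K) χ * (-1ℤ ℤ.^ m)                             ≡⟨ cong (_* (-1ℤ ℤ.^ m)) ∑-units-χ ⟩
    -1ℤ ℤ.^ suc m                                           ∎
    where open ≡-Reasoning

  vsum-scale : ∀ {m} x (v : Vec F m) → vsum K (Vec.map (x ⊗_) v) ≡ x ⊗ vsum K v
  vsum-scale x []      = sym (zeroʳ x)
  vsum-scale x (a ∷ v) = trans (cong (x ⊗ a ⊕_) (vsum-scale x v))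
    (solve 3 (λ x a s → x :* a :+ x :* s := x :* (a :+ s)) refl x a (vsum K v))

  vprod-scale : ∀ {m} x (v : Vec F m) → vprod K (Vec.map (x ⊗_) v) ≡ x ^ᶠ m ⊗ vprod K v
  vprod-scale x []                = sym (*-identityˡ 1#)
  vprod-scale {suc m} x (a ∷ v) = trans (cong (x ⊗ a ⊗_) (vprod-scale x v))
    (solve 4 (λ x a xᵐ p → x :* a :* (xᵐ :* p) := x :* xᵐ :* (a :* p)) refl x a (x ^ᶠ m) (vprod K v))

  vsum-sq : ∀ {m} (v : Vec F m) → vsum K (Vec.map sq v) ≡ sq (vsum K v)
  vsum-sq []      = sym (zeroˡ 0#)
  vsum-sq (a ∷ v) = trans (cong (sq a ⊕_) (vsum-sq v)) (sym (sq-⊕ a (vsum K v)))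

  vprod-sq : ∀ {m} (v : Vec F m) → vprod K (Vec.map sq v) ≡ sq (vprod K v)
  vprod-sq []      = sym (*-identityˡ 1#)
  vprod-sq (a ∷ v) = trans (cong (sq a ⊗_) (vprod-sq v)) (sym (sq-⊗ a (vprod K v)))

  vprod-≢0 : ∀ {m} {v : Vec F m} → AllV.All (_≢ 0#) v → vprod K v ≢ 0#
  vprod-≢0 []            = 1≢0
  vprod-≢0 (a≢0 ∷ v≢0) = ⊗-≢0 a≢0 (vprod-≢0 v≢0)

  Kl : ℕ → F → ℤ
  Kl m c = ∑[ v ← tuples K m ] χ (vsum K v ⊕ c ⊗ inv (vprod K v))

  Kloost≡Kl : ∀ m c → Kloost K r m c ≡ Kl m c
  Kloost≡Kl zero    c = sym (begin
    χ (0# ⊕ c ⊗ inv 1#) + + 0  ≡⟨ ℤ.+-identityʳ _ ⟩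
    χ (0# ⊕ c ⊗ inv 1#)        ≡⟨ cong (λ t → χ (0# ⊕ c ⊗ t)) inv-1 ⟩
    χ (0# ⊕ c ⊗ 1#)            ≡⟨ cong χ (trans (+-identityˡ _) (*-identityʳ c)) ⟩
    χ c                        ∎)
    where open ≡-Reasoning
  Kloost≡Kl (suc m) c = refl

  Kl-sq : ∀ m c → Kl m (sq c) ≡ Kl m c
  Kl-sq m c = trans (sym (∑-tuples-map sq-sqIter-[r∸1] sqIter-[r∸1]-sq (zeroˡ 0#) m _)) (∑-tuples-cong m summand)
    where
    summand : ∀ v → AllV.All (_≢ 0#) v →
      χ (vsum K (Vec.map sq v) ⊕ sq c ⊗ inv (vprod K (Vec.map sq v))) ≡ χ (vsum K v ⊕ c ⊗ inv (vprod K v))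
    summand v v≢0 = begin
      χ (vsum K (Vec.map sq v) ⊕ sq c ⊗ inv (vprod K (Vec.map sq v)))
        ≡⟨ cong₂ (λ s p → χ (s ⊕ sq c ⊗ inv p)) (vsum-sq v) (vprod-sq v) ⟩
      χ (sq (vsum K v) ⊕ sq c ⊗ inv (sq (vprod K v)))
        ≡⟨ cong (λ t → χ (sq (vsum K v) ⊕ sq c ⊗ t)) (inv-distrib-⊗ (vprod-≢0 v≢0) (vprod-≢0 v≢0)) ⟩
      χ (sq (vsum K v) ⊕ sq c ⊗ sq (inv (vprod K v)))
        ≡⟨ cong χ (trans (cong (sq (vsum K v) ⊕_) (sym (sq-⊗ c _))) (sym (sq-⊕ _ _))) ⟩
      χ (sq (vsum K v ⊕ c ⊗ inv (vprod K v)))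
        ≡⟨ χ-sq _ ⟩
      χ (vsum K v ⊕ c ⊗ inv (vprod K v)) ∎
      where open ≡-Reasoning

  Kl-sqIter : ∀ i m c → Kl m (sqIter K i c) ≡ Kl m c
  Kl-sqIter zero    m c = refl
  Kl-sqIter (suc i) m c = trans (cong (Kl m) (sqIter-sq i c)) (trans (Kl-sq m (sqIter K i c)) (Kl-sqIter i m c))

  sum+prod⁻¹ : ∀ {m} → Vec F m → F
  sum+prod⁻¹ v = vsum K v ⊕ inv (vprod K v)

  q*𝟙≡ψ : ∀ y β → + 2 ^ r * 𝟙 (y ≟ β) ≡ ψ (y ⊕ β)
  q*𝟙≡ψ y β with y ≟ β
  ... | yes refl = trans (ℤ.*-identityʳ (+ 2 ^ r)) (sym (trans (cong ψ (x⊕x≡0 y)) ψ-0))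
  ... | no  y≢β  = trans (ℤ.*-zeroʳ (+ 2 ^ r)) (sym (ψ-≢0 (y≢β ∘ x⊕y≡0⇒x≡y)))

  q*δ≡∑ψ : ∀ m β → + 2 ^ r * + δ K m β ≡ ∑[ v ← tuples K m ] ψ (sum+prod⁻¹ v ⊕ β)
  q*δ≡∑ψ m β = begin
    + 2 ^ r * + δ K m β                               ≡⟨ cong (+ 2 ^ r *_) (length-filter (λ v → sum+prod⁻¹ v ≟ β) (tuples K m)) ⟩
    + 2 ^ r * (∑[ v ← tuples K m ] 𝟙 (sum+prod⁻¹ v ≟ β)) ≡⟨ *-distribˡ-∑ (+ 2 ^ r) (tuples K m) (λ v → 𝟙 (sum+prod⁻¹ v ≟ β)) ⟩
    ∑[ v ← tuples K m ] + 2 ^ r * 𝟙 (sum+prod⁻¹ v ≟ β)   ≡⟨ ∑-cong (tuples K m) (λ {v} _ → q*𝟙≡ψ (sum+prod⁻¹ v) β) ⟩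
    ∑[ v ← tuples K m ] ψ (sum+prod⁻¹ v ⊕ β)            ∎
    where open ≡-Reasoning

  ∑ψ≡∑χ*∑χ : ∀ m β → ∑[ v ← tuples K m ] ψ (sum+prod⁻¹ v ⊕ β)
                   ≡ ∑[ x ← elems ] χ (x ⊗ β) * (∑[ v ← tuples K m ] χ (x ⊗ sum+prod⁻¹ v))
  ∑ψ≡∑χ*∑χ m β = trans (∑-comm (tuples K m) elems (λ v x → χ (x ⊗ (sum+prod⁻¹ v ⊕ β))))
    (∑-cong elems (λ {x} _ → trans (∑-cong (tuples K m) (λ {v} _ → split x (sum+prod⁻¹ v)))
                                   (sym (*-distribˡ-∑ (χ (x ⊗ β)) (tuples K m) _))))
    where
    split : ∀ x y → χ (x ⊗ (y ⊕ β)) ≡ χ (x ⊗ β) * χ (x ⊗ y)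
    split x y = trans (cong χ (solve 3 (λ x y β → x :* (y :+ β) := x :* β :+ x :* y) refl x y β)) (χ-⊕ _ _)

  x≡0-summand : ∀ m β → χ (0# ⊗ β) * (∑[ v ← tuples K m ] χ (0# ⊗ sum+prod⁻¹ v)) ≡ + (2 ^ r ∸ 1) ^ m
  x≡0-summand m β = begin
    χ (0# ⊗ β) * (∑[ v ← tuples K m ] χ (0# ⊗ sum+prod⁻¹ v)) ≡⟨ cong₂ _*_ χ[0⊗y]≡1 (∑-cong (tuples K m) (λ _ → χ[0⊗y]≡1)) ⟩
    + 1 * (∑[ _ ← tuples K m ] + 1)                          ≡⟨ ℤ.*-identityˡ _ ⟩
    ∑[ _ ← tuples K m ] + 1                                  ≡⟨ ∑-tuples-1 m ⟩
    + (2 ^ r ∸ 1) ^ m                                        ∎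
    where
    open ≡-Reasoning
    χ[0⊗y]≡1 : ∀ {y} → χ (0# ⊗ y) ≡ + 1
    χ[0⊗y]≡1 {y} = trans (cong χ (zeroˡ y)) χ-0

  ∑χ[x⊗sum+prod⁻¹] : ∀ s m → suc m ≡ 2 ^ s → ∀ {x} → x ≢ 0# →
    ∑[ v ← tuples K m ] χ (x ⊗ sum+prod⁻¹ v) ≡ Kl m (sqIter K s x)
  ∑χ[x⊗sum+prod⁻¹] s m sucm≡2^s {x} x≢0 =
    trans (∑-tuples-cong m summand) (∑-tuples-map (x⊗[x⁻¹⊗z]≡z x≢0) (x⁻¹⊗[x⊗z]≡z x≢0) (zeroʳ x) m _)
    where
    xˢ≡x⊗xᵐ : sqIter K s x ≡ x ⊗ x ^ᶠ m
    xˢ≡x⊗xᵐ = trans (sqIter-^ᶠ s x) (cong (x ^ᶠ_) (sym sucm≡2^s))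
    summand : ∀ v → AllV.All (_≢ 0#) v →
      χ (x ⊗ sum+prod⁻¹ v) ≡ χ (vsum K (Vec.map (x ⊗_) v) ⊕ sqIter K s x ⊗ inv (vprod K (Vec.map (x ⊗_) v)))
    summand v v≢0 = cong χ (sym (begin
      vsum K (Vec.map (x ⊗_) v) ⊕ sqIter K s x ⊗ inv (vprod K (Vec.map (x ⊗_) v))
        ≡⟨ cong₂ (λ a b → a ⊕ sqIter K s x ⊗ inv b) (vsum-scale x v) (vprod-scale x v) ⟩
      x ⊗ vsum K v ⊕ sqIter K s x ⊗ inv (x ^ᶠ m ⊗ vprod K v)
        ≡⟨ cong (λ t → x ⊗ vsum K v ⊕ t ⊗ inv (x ^ᶠ m ⊗ vprod K v)) xˢ≡x⊗xᵐ ⟩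
      x ⊗ vsum K v ⊕ x ⊗ x ^ᶠ m ⊗ inv (x ^ᶠ m ⊗ vprod K v)
        ≡⟨ cong (x ⊗ vsum K v ⊕_) (x⊗w⊗[w⊗y]⁻¹≡x⊗y⁻¹ x (^ᶠ-≢0 m x≢0) (vprod-≢0 v≢0)) ⟩
      x ⊗ vsum K v ⊕ x ⊗ inv (vprod K v)
        ≡⟨ solve 3 (λ x s p → x :* s :+ x :* p := x :* (s :+ p)) refl x (vsum K v) (inv (vprod K v)) ⟩
      x ⊗ sum+prod⁻¹ v ∎))
      where open ≡-Reasoning

  ∑-units-frobenius : ∀ s m β → ∑[ x ← units K ] χ (x ⊗ β) * Kl m (sqIter K s x)
                              ≡ ∑[ a ← units K ] χ (a ⊗ sqIter K s β) * Kl m a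
  ∑-units-frobenius s m β = trans (∑-cong (units K) (λ {x} _ → cong (_* Kl m (sqIter K s x)) (χ[x⊗β] x)))
                                  (∑-units-sqIter s (λ a → χ (a ⊗ sqIter K s β) * Kl m a))
    where
    χ[x⊗β] : ∀ x → χ (x ⊗ β) ≡ χ (sqIter K s x ⊗ sqIter K s β)
    χ[x⊗β] x = trans (sym (χ-sqIter s (x ⊗ β))) (cong χ (sqIter-⊗ s x β))

  M : ℕ → F → ℤ
  M m b = ∑[ v ← tuples K m ] χ (vsum K v) * ψ (b ⊕ inv (vprod K v))

  ∑-units-χ*Kl : ∀ m b → (∑[ a ← units K ] χ (a ⊗ b) * Kl m a) + -1ℤ ℤ.^ m ≡ M m b
  ∑-units-χ*Kl m b = sym (begin
    ∑[ v ← tuples K m ] χ (vsum K v) * ψ (c v)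
      ≡⟨ ∑-cong (tuples K m) (λ {v} _ → trans (cong (χ (vsum K v) *_) (ψ≡1+∑units (c v))) (s*[1+t]≡s*t+s (χ (vsum K v)) _)) ⟩
    ∑[ v ← tuples K m ] (χ (vsum K v) * (∑[ a ← units K ] χ (a ⊗ c v)) + χ (vsum K v))
      ≡⟨ ∑-∙ (tuples K m) _ _ ⟩
    (∑[ v ← tuples K m ] χ (vsum K v) * (∑[ a ← units K ] χ (a ⊗ c v))) + (∑[ v ← tuples K m ] χ (vsum K v))
      ≡⟨ cong₂ _+_ swap (∑-tuples-χ m) ⟩
    (∑[ a ← units K ] χ (a ⊗ b) * Kl m a) + -1ℤ ℤ.^ m ∎)
    where
    open ≡-Reasoning
    c : Vec F m → F
    c v = b ⊕ inv (vprod K v)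
    s*[1+t]≡s*t+s : ∀ s t → s * (+ 1 + t) ≡ s * t + s
    s*[1+t]≡s*t+s = solve-∀
    s*[t*u]≡t*[s*u] : ∀ s t u → s * (t * u) ≡ t * (s * u)
    s*[t*u]≡t*[s*u] = solve-∀
    summand : ∀ a v → χ (vsum K v) * χ (a ⊗ c v) ≡ χ (a ⊗ b) * χ (vsum K v ⊕ a ⊗ inv (vprod K v))
    summand a v = begin
      χ (vsum K v) * χ (a ⊗ c v)
        ≡⟨ cong (λ t → χ (vsum K v) * χ t) (solve 3 (λ a b p → a :* (b :+ p) := a :* b :+ a :* p) refl a b _) ⟩
      χ (vsum K v) * χ (a ⊗ b ⊕ a ⊗ inv (vprod K v))                  ≡⟨ cong (χ (vsum K v) *_) (χ-⊕ _ _) ⟩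
      χ (vsum K v) * (χ (a ⊗ b) * χ (a ⊗ inv (vprod K v)))            ≡⟨ s*[t*u]≡t*[s*u] (χ (vsum K v)) (χ (a ⊗ b)) _ ⟩
      χ (a ⊗ b) * (χ (vsum K v) * χ (a ⊗ inv (vprod K v)))            ≡⟨ cong (χ (a ⊗ b) *_) (sym (χ-⊕ _ _)) ⟩
      χ (a ⊗ b) * χ (vsum K v ⊕ a ⊗ inv (vprod K v))                  ∎
    swap : ∑[ v ← tuples K m ] χ (vsum K v) * (∑[ a ← units K ] χ (a ⊗ c v)) ≡ ∑[ a ← units K ] χ (a ⊗ b) * Kl m a
    swap = begin
      ∑[ v ← tuples K m ] χ (vsum K v) * (∑[ a ← units K ] χ (a ⊗ c v))
        ≡⟨ ∑-cong (tuples K m) (λ {v} _ → *-distribˡ-∑ (χ (vsum K v)) (units K) _) ⟩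
      ∑[ v ← tuples K m ] ∑[ a ← units K ] χ (vsum K v) * χ (a ⊗ c v)
        ≡⟨ ∑-comm (tuples K m) (units K) _ ⟩
      ∑[ a ← units K ] ∑[ v ← tuples K m ] χ (vsum K v) * χ (a ⊗ c v)
        ≡⟨ ∑-cong (units K) (λ {a} _ → ∑-cong (tuples K m) (λ {v} _ → summand a v)) ⟩
      ∑[ a ← units K ] ∑[ v ← tuples K m ] χ (a ⊗ b) * χ (vsum K v ⊕ a ⊗ inv (vprod K v))
        ≡⟨ ∑-cong (units K) (λ {a} _ → sym (*-distribˡ-∑ (χ (a ⊗ b)) (tuples K m) _)) ⟩
      ∑[ a ← units K ] χ (a ⊗ b) * Kl m a ∎

  M-0 : ∀ m → M m 0# ≡ + 0
  M-0 m = trans (∑-tuples-cong m vanish) (∑-ε (tuples K m))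
    where
    vanish : ∀ v → AllV.All (_≢ 0#) v → χ (vsum K v) * ψ (0# ⊕ inv (vprod K v)) ≡ + 0
    vanish v v≢0 = trans (cong (χ (vsum K v) *_) (trans (cong ψ (+-identityˡ _)) (ψ-≢0 (inv-≢0 (vprod-≢0 v≢0)))))
                         (ℤ.*-zeroʳ (χ (vsum K v)))

  -- Only the unit a = (b Πw)⁻¹ in the first coordinate makes the argument of ψ vanish.
  M-≢0 : ∀ k {b} → b ≢ 0# → M (suc k) b ≡ + 2 ^ r * Kl k (inv b)
  M-≢0 k {b} b≢0 = begin
    M (suc k) b                                   ≡⟨ ∑-cartesianProductWith _∷_ (units K) (tuples K k) _ ⟩
    ∑[ a ← units K ] ∑[ w ← tuples K k ] f w a    ≡⟨ ∑-comm (units K) (tuples K k) _ ⟩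
    ∑[ w ← tuples K k ] ∑[ a ← units K ] f w a    ≡⟨ ∑-tuples-cong k inner ⟩
    ∑[ w ← tuples K k ] + 2 ^ r * χ (vsum K w ⊕ inv b ⊗ inv (vprod K w)) ≡⟨ sym (*-distribˡ-∑ (+ 2 ^ r) (tuples K k) _) ⟩
    + 2 ^ r * Kl k (inv b)                        ∎
    where
    open ≡-Reasoning
    f : Vec F k → F → ℤ
    f w a = χ (a ⊕ vsum K w) * ψ (b ⊕ inv (a ⊗ vprod K w))
    inner : ∀ w → AllV.All (_≢ 0#) w → ∑[ a ← units K ] f w a ≡ + 2 ^ r * χ (vsum K w ⊕ inv b ⊗ inv (vprod K w))
    inner w w≢0 = trans (∑-singleSupport _≟_ (units K) (f w) units-unique (∈-units⁺ a₀≢0) vanish) f[a₀]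
      where
      P = vprod K w
      P≢0 = vprod-≢0 w≢0
      a₀ = inv b ⊗ inv P
      a₀≢0 = ⊗-≢0 (inv-≢0 b≢0) (inv-≢0 P≢0)
      a₀⊗P≡b⁻¹ : a₀ ⊗ P ≡ inv b
      a₀⊗P≡b⁻¹ = trans (*-assoc (inv b) (inv P) P) (trans (cong (inv b ⊗_) (inv-l P≢0)) (*-identityʳ (inv b)))
      b⊕[a₀⊗P]⁻¹≡0 : b ⊕ inv (a₀ ⊗ P) ≡ 0#
      b⊕[a₀⊗P]⁻¹≡0 = trans (cong (λ t → b ⊕ inv t) (a₀⊗P≡b⁻¹))
                            (trans (cong (b ⊕_) (inv-involutive b≢0)) (x⊕x≡0 b))
      f[a₀] : f w a₀ ≡ + 2 ^ r * χ (vsum K w ⊕ a₀)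
      f[a₀] = trans (cong₂ _*_ (cong χ (+-comm a₀ (vsum K w))) (trans (cong ψ b⊕[a₀⊗P]⁻¹≡0) ψ-0))
                    (ℤ.*-comm (χ (vsum K w ⊕ a₀)) (+ 2 ^ r))
      vanish : ∀ {a} → a ∈ units K → a ≢ a₀ → f w a ≡ + 0
      vanish {a} a∈ a≢a₀ = trans (cong (χ (a ⊕ vsum K w) *_) (ψ-≢0 c≢0)) (ℤ.*-zeroʳ (χ (a ⊕ vsum K w)))
        where
        c≢0 : b ⊕ inv (a ⊗ P) ≢ 0#
        c≢0 c≡0 = a≢a₀ (begin
          a                   ≡⟨ sym (x⊗y⊗y⁻¹≡x a P≢0) ⟩
          a ⊗ P ⊗ inv P       ≡⟨ cong (_⊗ inv P) (sym (inv-involutive (⊗-≢0 (∈-units⁻ a∈) P≢0))) ⟩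
          inv (inv (a ⊗ P)) ⊗ inv P ≡⟨ cong (λ t → inv t ⊗ inv P) (sym (x⊕y≡0⇒x≡y c≡0)) ⟩
          inv b ⊗ inv P       ∎)

  M-≢0-Kloost : ∀ s k {β} → β ≢ 0# → M (suc k) (sqIter K s β) ≡ + 2 ^ r * Kloost K r k (inv β)
  M-≢0-Kloost s k {β} β≢0 = begin
    M (suc k) (sqIter K s β)                ≡⟨ M-≢0 k (sqIter-≢0 s β≢0) ⟩
    + 2 ^ r * Kl k (inv (sqIter K s β))     ≡⟨ cong (λ c → + 2 ^ r * Kl k c) (inv-sqIter s β≢0) ⟩
    + 2 ^ r * Kl k (sqIter K s (inv β))     ≡⟨ cong (+ 2 ^ r *_) (Kl-sqIter s k (inv β)) ⟩
    + 2 ^ r * Kl k (inv β)                  ≡⟨ cong (+ 2 ^ r *_) (sym (Kloost≡Kl k (inv β))) ⟩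
    + 2 ^ r * Kloost K r k (inv β)          ∎
    where open ≡-Reasoning

  δ-formula : ∀ s m → suc m ≡ 2 ^ s → -1ℤ ℤ.^ m ≡ -1ℤ → ∀ β →
    + 2 ^ r * + δ K m β ≡ + (2 ^ r ∸ 1) ^ m + (M m (sqIter K s β) + + 1)
  δ-formula s m sucm≡2^s -1ᵐ≡-1 β = begin
    + 2 ^ r * + δ K m β
      ≡⟨ q*δ≡∑ψ m β ⟩
    ∑[ v ← tuples K m ] ψ (sum+prod⁻¹ v ⊕ β)
      ≡⟨ ∑ψ≡∑χ*∑χ m β ⟩
    ∑[ x ← elems ] χ (x ⊗ β) * (∑[ v ← tuples K m ] χ (x ⊗ sum+prod⁻¹ v))
      ≡⟨ ∑-elements _ ⟩
    χ (0# ⊗ β) * (∑[ v ← tuples K m ] χ (0# ⊗ sum+prod⁻¹ v))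
      + (∑[ x ← units K ] χ (x ⊗ β) * (∑[ v ← tuples K m ] χ (x ⊗ sum+prod⁻¹ v)))
      ≡⟨ cong₂ _+_ (x≡0-summand m β)
                   (∑-cong (units K) (λ {x} x∈ → cong (χ (x ⊗ β) *_) (∑χ[x⊗sum+prod⁻¹] s m sucm≡2^s (∈-units⁻ x∈)))) ⟩
    + (2 ^ r ∸ 1) ^ m + (∑[ x ← units K ] χ (x ⊗ β) * Kl m (sqIter K s x))
      ≡⟨ cong (_+_ (+ (2 ^ r ∸ 1) ^ m)) (trans (∑-units-frobenius s m β) S≡M+1) ⟩
    + (2 ^ r ∸ 1) ^ m + (M m (sqIter K s β) + + 1) ∎
    where
    open ≡-Reasoning
    S = ∑[ a ← units K ] χ (a ⊗ sqIter K s β) * Kl m a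
    x≡[x-1]+1 : ∀ x → x ≡ x + -1ℤ + + 1
    x≡[x-1]+1 = solve-∀
    S≡M+1 : S ≡ M m (sqIter K s β) + + 1
    S≡M+1 = trans (x≡[x-1]+1 S) (cong (_+ + 1) (trans (cong (_+_ S) (sym -1ᵐ≡-1)) (∑-units-χ*Kl m (sqIter K s β))))

n∸1≡suc[n∸2] : ∀ {n} → 2 ≤ n → n ∸ 1 ≡ suc (n ∸ 2)
n∸1≡suc[n∸2] (s≤s (s≤s _)) = refl

suc[2^s∸1]≡2^s : ∀ s → suc (2 ^ s ∸ 1) ≡ 2 ^ s
suc[2^s∸1]≡2^s s = suc[n∸1]≡n (ℕ.m^n>0 2 s)

2≤2^s : ∀ s → 1 ≤ s → 2 ≤ 2 ^ s
2≤2^s (suc s) _ = ℕ.*-monoʳ-≤ 2 (ℕ.m^n>0 2 s)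

-1^[2^s∸1]≡-1 : ∀ s → 1 ≤ s → -1ℤ ℤ.^ (2 ^ s ∸ 1) ≡ -1ℤ
-1^[2^s∸1]≡-1 (suc s) _ = begin
  -1ℤ ℤ.^ n                   ≡⟨ sym (ℤ.neg-involutive _) ⟩
  - - (-1ℤ ℤ.^ n)             ≡⟨ cong -_ (sym (ℤ.-1*i≡-i _)) ⟩
  - (-1ℤ ℤ.^ suc n)           ≡⟨ cong (λ k → - (-1ℤ ℤ.^ k)) (suc[2^s∸1]≡2^s (suc s)) ⟩
  - (-1ℤ ℤ.^ (2 ℕ.* 2 ^ s))   ≡⟨ cong -_ (sym (ℤ.^-*-assoc -1ℤ 2 (2 ^ s))) ⟩
  - (ℤ.1ℤ ℤ.^ 2 ^ s)          ≡⟨ cong -_ (ℤ.^-zeroˡ (2 ^ s)) ⟩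
  -1ℤ                         ∎
  where
  open ≡-Reasoning
  n = 2 ^ suc s ∸ 1

proposition11 : (s r : ℕ) → 1 ≤ s → 1 ≤ r → (K : FiniteField (2 ^ r)) →
    ((+ (2 ^ r)) * (+ δ K (2 ^ s ∸ 1) (FiniteField.0# K))
       ≡ + ((2 ^ r ∸ 1) ^ (2 ^ s ∸ 1) Data.Nat.+ 1))
    × ((β : FiniteField.F K) → ¬ (β ≡ FiniteField.0# K) →
       (+ (2 ^ r)) * (+ δ K (2 ^ s ∸ 1) β)
         ≡ (+ (2 ^ r)) * Kloost K r (2 ^ s ∸ 2) (FiniteField.inv K β)
           + (+ ((2 ^ r ∸ 1) ^ (2 ^ s ∸ 1) Data.Nat.+ 1)))
proposition11 s r 1≤s 1≤r K = β≡0-case , β≢0-case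
  where
  open Counting r K 1≤r
  m = 2 ^ s ∸ 1
  A = (2 ^ r ∸ 1) ^ m
  formula = δ-formula s m (suc[2^s∸1]≡2^s s) (-1^[2^s∸1]≡-1 s 1≤s)
  β≡0-case = trans (formula 0#) (cong (λ t → + A + (t + + 1)) (trans (cong (M m) (sqIter-0 s)) (M-0 m)))
  β≢0-case : (β : F) → β ≢ 0# → _
  β≢0-case β β≢0 = begin
    + 2 ^ r * + δ K m β               ≡⟨ formula β ⟩
    + A + (M m (sqIter K s β) + + 1)  ≡⟨ cong (λ t → + A + (t + + 1)) M≡q*Kloost ⟩
    + A + (q*Kloost + + 1)            ≡⟨ a+[k+1]≡k+[a+1] (+ A) q*Kloost ⟩
    q*Kloost + (+ A + + 1)            ∎
    where
    open ≡-Reasoning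
    q*Kloost = + 2 ^ r * Kloost K r (2 ^ s ∸ 2) (inv β)
    a+[k+1]≡k+[a+1] : ∀ a k → a + (k + + 1) ≡ k + (a + + 1)
    a+[k+1]≡k+[a+1] = solve-∀
    M≡q*Kloost : M m (sqIter K s β) ≡ q*Kloost
    M≡q*Kloost = trans (cong (λ n → M n (sqIter K s β)) (n∸1≡suc[n∸2] (2≤2^s s 1≤s))) (M-≢0-Kloost s (2 ^ s ∸ 2) β≢0)
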